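{- Let $\langle X,\tau,\le,\eta_1,\eta_2\rangle$ be a modal Esakia space. Then $\langle\mathcal{U}(X),\Box_{\eta_1},\Diamond_{\eta_2}\rangle$ is a modal Heyting algebra, where $\Box_{\eta_1}(U)=\{x\in X: U\in\eta_1(x)\}$ and $\Diamond_{\eta_2}(U)=\{x\in X: X\setminus U\notin\eta_2(x)\}$.
   Context: An Esakia space is a compact ordered space $\langle X,\tau,\le\rangle$ such that if $x\not\le y$ there is a clopen up-set containing $x$ but not $y$, and ${\downarrow}U$ is clopen for every clopen $U$. $\mathcal{U}(X)$ (clopen up-sets) is a Heyting algebra under $\cap,\cup,\emptyset,X$ and $U\to V=\{x: {\uparrow}x\cap U\subseteq V\}$; $\mathcal{D}(X)$ denotes the clopen down-sets. A modal Esakia space is $\langle X,\tau,\le,\eta_1,\eta_2\rangle$ with $\langle X,\tau,\le\rangle$ an Esakia space and $\eta_1,\eta_2\colon X\to\mathcal{P}(\mathcal{P}(X))$ such that for all $x\in X$ and $U,V\in\mathcal{U}(X)$: (1) $\eta_1(x)\subseteq\mathcal{U}(X)$ and $\eta_2(x)\subseteq\mathcal{D}(X)$; (2) $\Box_{\eta_1}(U)$ and $\Diamond_{\eta_2}(U)$ are clopen up-sets; (3) if $U\in\eta_1(x)$ then ${\downarrow}U\cup(X\setminus V)\in\eta_2(x)$. A modal Heyting algebra is a Heyting algebra with unary $\Box,\Diamond$ satisfying $\Box a\wedge\Diamond(-a\wedge b)=\bot$, where $-a=a\rightharpoonup\bot$. -}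

module Defs where

open import Level using (0ℓ) renaming (suc to lsuc)
open import Data.Product using (Σ; ∃; _×_; _,_; proj₁; proj₂)
open import Data.Sum using (_⊎_)
open import Data.Empty using (⊥)
open import Data.Unit using (⊤)
open import Data.List using (List)
open import Data.List.Membership.Propositional using (_∈_)
open import Data.List.Relation.Unary.Any using (Any)
open import Relation.Nullary using (¬_)
open import Relation.Binary.Core using (Rel)
open import Relation.Binary.PropositionalEquality using (_≡_)
open import Relation.Binary.Structures using (IsPartialOrder)
import Relation.Binary.Lattice.Structures as LS

Subset : Set → Set₁
Subset X = X → Set

module _ {X : Set} where

  infix 4 _⊆_ _≐_
  _⊆_ : Subset X → Subset X → Set
  U ⊆ V = ∀ x → U x → V x

  _≐_ : Subset X → Subset X → Set
  U ≐ V = (U ⊆ V) × (V ⊆ U)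

  ∅ : Subset X
  ∅ _ = ⊥

  Whole : Subset X
  Whole _ = ⊤

  _∩_ : Subset X → Subset X → Subset X
  (U ∩ V) x = U x × V x

  _∪_ : Subset X → Subset X → Subset X
  (U ∪ V) x = U x ⊎ V x

  ∁ : Subset X → Subset X
  ∁ U x = ¬ U x

record IsTopology (X : Set) (Open : Subset X → Set) : Set₁ where
  field
    open-resp   : ∀ {U V} → U ≐ V → Open U → Open V   -- sets are extensional
    open-∅      : Open ∅
    open-whole  : Open Whole
    open-∩      : ∀ {U V} → Open U → Open V → Open (U ∩ V)
    open-⋃      : (I : Set) (F : I → Subset X) → (∀ i → Open (F i)) →
                  Open (λ x → ∃ λ i → F i x)

IsCompact : (X : Set) → (Subset X → Set) → Set₁
IsCompact X Open =
  (I : Set) (F : I → Subset X) → (∀ i → Open (F i)) →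
  (∀ x → ∃ λ i → F i x) →
  ∃ λ (is : List I) → ∀ x → Any (λ i → F i x) is

record EsakiaSpace : Set₁ where
  field
    X      : Set
    Open   : Subset X → Set
    _≤_    : Rel X 0ℓ
    isTopology     : IsTopology X Open
    isCompact      : IsCompact X Open
    isPartialOrder : IsPartialOrder _≡_ _≤_

  Clopen : Subset X → Set
  Clopen U = Open U × Open (∁ U)

  IsUp : Subset X → Set
  IsUp U = ∀ {x y} → x ≤ y → U x → U y

  IsDown : Subset X → Set
  IsDown U = ∀ {x y} → y ≤ x → U x → U y

  ClopenUp : Subset X → Set
  ClopenUp U = Clopen U × IsUp U

  ClopenDown : Subset X → Set
  ClopenDown U = Clopen U × IsDown U

  ↑_ : X → Subset X
  (↑ x) y = x ≤ y

  ↓ : Subset X → Subset X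
  ↓ U x = ∃ λ y → x ≤ y × U y

  _⇒_ : Subset X → Subset X → Subset X
  (U ⇒ V) x = ∀ y → x ≤ y → U y → V y

  field
    esakia-separation : ∀ {x y} → ¬ (x ≤ y) →
                        ∃ λ U → ClopenUp U × U x × ¬ U y
    ↓-clopen          : ∀ {U} → Clopen U → Clopen (↓ U)

record ModalEsakiaSpace : Set₂ where
  field
    esakia : EsakiaSpace
  open EsakiaSpace esakia public
  field
    η₁ η₂ : X → Subset X → Set
    -- each η i (x) is a set of (extensional) subsets of X
    η₁-resp : ∀ {x U V} → U ≐ V → η₁ x U → η₁ x V
    η₂-resp : ∀ {x U V} → U ≐ V → η₂ x U → η₂ x V

  □η : Subset X → Subset X
  □η U x = η₁ x U

  ◇η : Subset X → Subset X
  ◇η U x = ¬ η₂ x (∁ U)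

  field
    η₁⊆𝒰 : ∀ {x U} → η₁ x U → ClopenUp U
    η₂⊆𝒟 : ∀ {x U} → η₂ x U → ClopenDown U
    □-𝒰 : ∀ {U} → ClopenUp U → ClopenUp (□η U)
    ◇-𝒰 : ∀ {U} → ClopenUp U → ClopenUp (◇η U)
    η₁→η₂ : ∀ {x U V} → ClopenUp U → ClopenUp V →
            η₁ x U → η₂ x (↓ U ∪ ∁ V)

record IsModalHeytingAlgebra {A : Set₁} (_≈_ : Rel A 0ℓ) (_≤_ : Rel A 0ℓ)
    (_∨_ _∧_ _⇨_ : A → A → A) (⊤ᴬ ⊥ᴬ : A) (□ ◇ : A → A) : Set₁ where
  field
    isHeytingAlgebra : LS.IsHeytingAlgebra _≈_ _≤_ _∨_ _∧_ _⇨_ ⊤ᴬ ⊥ᴬ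
    □-cong : ∀ {a b} → a ≈ b → □ a ≈ □ b
    ◇-cong : ∀ {a b} → a ≈ b → ◇ a ≈ ◇ b
    axiom  : ∀ a b → (□ a ∧ ◇ ((a ⇨ ⊥ᴬ) ∧ b)) ≈ ⊥ᴬ

-- The algebra ⟨𝒰(X), ∩, ∪, ∅, X, ⇒, □_{η₁}, ◇_{η₂}⟩.
-- Closure of 𝒰(X) under the operations is recorded explicitly so that
-- the operations can be defined on the carrier Σ (Subset X) ClopenUp.

module _ (M : ModalEsakiaSpace) where
  open ModalEsakiaSpace M

  record 𝒰-Closed : Set₁ where
    field
      ∩-cl : ∀ {U V} → ClopenUp U → ClopenUp V → ClopenUp (U ∩ V)
      ∪-cl : ∀ {U V} → ClopenUp U → ClopenUp V → ClopenUp (U ∪ V)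
      ⇒-cl : ∀ {U V} → ClopenUp U → ClopenUp V → ClopenUp (U ⇒ V)
      ∅-cl : ClopenUp ∅
      X-cl : ClopenUp Whole

  𝒰 : Set₁
  𝒰 = Σ (Subset X) ClopenUp

  _≈𝒰_ : Rel 𝒰 0ℓ
  A ≈𝒰 B = proj₁ A ≐ proj₁ B

  _≤𝒰_ : Rel 𝒰 0ℓ
  A ≤𝒰 B = proj₁ A ⊆ proj₁ B

  □𝒰 : 𝒰 → 𝒰
  □𝒰 (U , p) = □η U , □-𝒰 p

  ◇𝒰 : 𝒰 → 𝒰
  ◇𝒰 (U , p) = ◇η U , ◇-𝒰 p

  module _ (c : 𝒰-Closed) where
    open 𝒰-Closed c

    _∨𝒰_ _∧𝒰_ _⇨𝒰_ : 𝒰 → 𝒰 → 𝒰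
    (U , p) ∨𝒰 (V , q) = U ∪ V , ∪-cl p q
    (U , p) ∧𝒰 (V , q) = U ∩ V , ∩-cl p q
    (U , p) ⇨𝒰 (V , q) = U ⇒ V , ⇒-cl p q

    ⊤𝒰 ⊥𝒰 : 𝒰
    ⊤𝒰 = Whole , X-cl
    ⊥𝒰 = ∅ , ∅-cl

  𝒰IsModalHeytingAlgebra : Set₁
  𝒰IsModalHeytingAlgebra =
    Σ 𝒰-Closed λ c →
      IsModalHeytingAlgebra _≈𝒰_ _≤𝒰_ (_∨𝒰_ c) (_∧𝒰_ c) (_⇨𝒰_ c)
                            (⊤𝒰 c) (⊥𝒰 c) □𝒰 ◇𝒰

-- Classically, U ⇒ V is the complement of ↓(U ∖ V), so the Esakia axiom that ↓
-- preserves clopens makes 𝒰(X) closed under ⇒; the lattice and residuation laws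
-- hold for up-sets of any preorder. For the modal axiom, condition (3) applied to
-- U and V puts ↓U ∪ (X ∖ V) in η₂(x) whenever x ∈ □U, and ↓U ∪ (X ∖ V) is exactly
-- the complement of -U ∩ V, so x ∉ ◇(-U ∩ V).

{-# OPTIONS --safe #-}
module Submission where

open import Defs
open import Level using (0ℓ)
open import Axiom.ExcludedMiddle using (ExcludedMiddle)
open import Axiom.DoubleNegationElimination using (DoubleNegationElimination; em⇒dne)
open import Data.Bool using (Bool; true; false)
open import Data.Product using (∃; _×_; _,_; proj₁; proj₂)
open import Data.Sum using (inj₁; inj₂; [_,_])
open import Data.Unit using (tt)
open import Function using (_∘_)
open import Relation.Binary.Structures using (IsPartialOrder)
open import Relation.Binary.Lattice.Definitions using (Supremum; Infimum)
import Relation.Binary.Construct.On as On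
import Relation.Binary.Lattice.Structures as LS

module SubsetProperties {X : Set} where

  ⊆-refl : {U : Subset X} → U ⊆ U
  ⊆-refl _ u = u

  ⊆-trans : {U V W : Subset X} → U ⊆ V → V ⊆ W → U ⊆ W
  ⊆-trans U⊆V V⊆W x = V⊆W x ∘ U⊆V x

  ≐-refl : {U : Subset X} → U ≐ U
  ≐-refl = ⊆-refl , ⊆-refl

  ≐-sym : {U V : Subset X} → U ≐ V → V ≐ U
  ≐-sym (U⊆V , V⊆U) = V⊆U , U⊆V

  ≐-trans : {U V W : Subset X} → U ≐ V → V ≐ W → U ≐ W
  ≐-trans (U⊆V , V⊆U) (V⊆W , W⊆V) = ⊆-trans U⊆V V⊆W , ⊆-trans W⊆V V⊆U

  ⊆-isPartialOrder : IsPartialOrder (_≐_ {X}) _⊆_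
  ⊆-isPartialOrder = record
    { isPreorder = record
      { isEquivalence = record
        { refl  = ≐-refl
        ; sym   = ≐-sym
        ; trans = ≐-trans
        }
      ; reflexive = proj₁
      ; trans     = ⊆-trans
      }
    ; antisym = _,_
    }

  ∪-supremum : Supremum (_⊆_ {X}) _∪_
  ∪-supremum U V = (λ _ → inj₁) , (λ _ → inj₂) , λ W U⊆W V⊆W x → [ U⊆W x , V⊆W x ]

  ∩-infimum : Infimum (_⊆_ {X}) _∩_
  ∩-infimum U V = (λ _ → proj₁) , (λ _ → proj₂) , λ W W⊆U W⊆V x w → W⊆U x w , W⊆V x w

  ∁-resp-≐ : {U V : Subset X} → U ≐ V → ∁ U ≐ ∁ V
  ∁-resp-≐ (U⊆V , V⊆U) = (λ x ¬u v → ¬u (V⊆U x v)) , (λ x ¬v u → ¬v (U⊆V x u))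

  ∪-resp-≐ : {U U′ V V′ : Subset X} → U ≐ U′ → V ≐ V′ → U ∪ V ≐ U′ ∪ V′
  ∪-resp-≐ (U⊆U′ , U′⊆U) (V⊆V′ , V′⊆V) =
    (λ x → [ inj₁ ∘ U⊆U′ x , inj₂ ∘ V⊆V′ x ]) , (λ x → [ inj₁ ∘ U′⊆U x , inj₂ ∘ V′⊆V x ])

  ∁-∅ : ∁ ∅ ≐ Whole {X}
  ∁-∅ = (λ _ _ → tt) , (λ _ _ ())

  ∁-Whole : ∁ Whole ≐ ∅ {X}
  ∁-Whole = (λ _ ¬t → ¬t tt) , (λ _ ())

  ∁-∪ : {U V : Subset X} → ∁ (U ∪ V) ≐ ∁ U ∩ ∁ V
  ∁-∪ = (λ _ ¬uv → ¬uv ∘ inj₁ , ¬uv ∘ inj₂) , (λ _ (¬u , ¬v) → [ ¬u , ¬v ])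

  module _ (dne : DoubleNegationElimination 0ℓ) where

    ∁-∁ : {U : Subset X} → ∁ (∁ U) ≐ U
    ∁-∁ = (λ _ → dne) , (λ _ u ¬u → ¬u u)

    ∁-∩ : {U V : Subset X} → ∁ (U ∩ V) ≐ ∁ U ∪ ∁ V
    ∁-∩ = (λ _ ¬uv → dne λ ¬∪ → ¬∪ (inj₁ λ u → ¬∪ (inj₂ λ v → ¬uv (u , v))))
        , (λ _ → [ (λ ¬u → ¬u ∘ proj₁) , (λ ¬v → ¬v ∘ proj₂) ])

module ClopenProperties {X : Set} {Open : Subset X → Set} (T : IsTopology X Open) where
  open IsTopology T
  open SubsetProperties

  IsClopen : Subset X → Set
  IsClopen U = Open U × Open (∁ U)

  open-∪ : {U V : Subset X} → Open U → Open V → Open (U ∪ V)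
  open-∪ {U} {V} oU oV = open-resp ⋃≐∪ (open-⋃ Bool pick λ { true → oU ; false → oV })
    where
    pick : Bool → Subset X
    pick true  = U
    pick false = V

    ⋃≐∪ : (λ x → ∃ λ b → pick b x) ≐ U ∪ V
    ⋃≐∪ = (λ { _ (true , u) → inj₁ u ; _ (false , v) → inj₂ v })
        , (λ _ → [ (true ,_) , (false ,_) ])

  clopen-resp : {U V : Subset X} → U ≐ V → IsClopen U → IsClopen V
  clopen-resp U≐V (oU , o∁U) = open-resp U≐V oU , open-resp (∁-resp-≐ U≐V) o∁U

  clopen-∅ : IsClopen ∅
  clopen-∅ = open-∅ , open-resp (≐-sym ∁-∅) open-whole

  clopen-Whole : IsClopen Whole
  clopen-Whole = open-whole , open-resp (≐-sym ∁-Whole) open-∅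

  clopen-∪ : {U V : Subset X} → IsClopen U → IsClopen V → IsClopen (U ∪ V)
  clopen-∪ (oU , o∁U) (oV , o∁V) = open-∪ oU oV , open-resp (≐-sym ∁-∪) (open-∩ o∁U o∁V)

  module _ (dne : DoubleNegationElimination 0ℓ) where

    clopen-∁ : {U : Subset X} → IsClopen U → IsClopen (∁ U)
    clopen-∁ (oU , o∁U) = o∁U , open-resp (≐-sym (∁-∁ dne)) oU

    clopen-∩ : {U V : Subset X} → IsClopen U → IsClopen V → IsClopen (U ∩ V)
    clopen-∩ (oU , o∁U) (oV , o∁V) = open-∩ oU oV , open-resp (≐-sym (∁-∩ dne)) (open-∪ o∁U o∁V)

module UpSetProperties (E : EsakiaSpace) where
  open EsakiaSpace E
  open SubsetProperties
  open ClopenProperties isTopology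
  module ≤ = IsPartialOrder isPartialOrder

  up-∅ : IsUp ∅
  up-∅ _ ()

  up-Whole : IsUp Whole
  up-Whole _ _ = tt

  up-∪ : {U V : Subset X} → IsUp U → IsUp V → IsUp (U ∪ V)
  up-∪ upU upV x≤y = [ inj₁ ∘ upU x≤y , inj₂ ∘ upV x≤y ]

  up-∩ : {U V : Subset X} → IsUp U → IsUp V → IsUp (U ∩ V)
  up-∩ upU upV x≤y (u , v) = upU x≤y u , upV x≤y v

  up-⇒ : {U V : Subset X} → IsUp (U ⇒ V)
  up-⇒ x≤y U⇒V z y≤z = U⇒V z (≤.trans x≤y y≤z)

  ⇒-residual : {U V W : Subset X} → IsUp W → W ∩ U ⊆ V → W ⊆ U ⇒ V
  ⇒-residual upW W∩U⊆V x w y x≤y u = W∩U⊆V y (upW x≤y w , u)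

  ⇒-counit : {U V W : Subset X} → W ⊆ U ⇒ V → W ∩ U ⊆ V
  ⇒-counit W⊆U⇒V x (w , u) = W⊆U⇒V x w x ≤.refl u

  ⇒∅≐∁↓ : {U : Subset X} → (U ⇒ ∅) ≐ ∁ (↓ U)
  ⇒∅≐∁↓ = (λ _ ¬↑U (y , x≤y , u) → ¬↑U y x≤y u)
        , (λ _ ¬↓U y x≤y u → ¬↓U (y , x≤y , u))

  clopenUp-∅ : ClopenUp ∅
  clopenUp-∅ = clopen-∅ , up-∅

  clopenUp-Whole : ClopenUp Whole
  clopenUp-Whole = clopen-Whole , up-Whole

  clopenUp-∪ : {U V : Subset X} → ClopenUp U → ClopenUp V → ClopenUp (U ∪ V)
  clopenUp-∪ (cU , upU) (cV , upV) = clopen-∪ cU cV , up-∪ upU upV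

  module _ (dne : DoubleNegationElimination 0ℓ) where

    clopenUp-∩ : {U V : Subset X} → ClopenUp U → ClopenUp V → ClopenUp (U ∩ V)
    clopenUp-∩ (cU , upU) (cV , upV) = clopen-∩ dne cU cV , up-∩ upU upV

    ⇒≐∁↓∖ : {U V : Subset X} → (U ⇒ V) ≐ ∁ (↓ (U ∩ ∁ V))
    ⇒≐∁↓∖ = (λ _ U⇒V (y , x≤y , u , ¬v) → ¬v (U⇒V y x≤y u))
          , (λ _ ¬↓ y x≤y u → dne λ ¬v → ¬↓ (y , x≤y , u , ¬v))

    clopenUp-⇒ : {U V : Subset X} → ClopenUp U → ClopenUp V → ClopenUp (U ⇒ V)
    clopenUp-⇒ (cU , _) (cV , _) =
      clopen-resp (≐-sym ⇒≐∁↓∖) (clopen-∁ dne (↓-clopen (clopen-∩ dne cU (clopen-∁ dne cV)))) ,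
      up-⇒

    ∁⇒∅≐↓ : {U : Subset X} → ∁ (U ⇒ ∅) ≐ ↓ U
    ∁⇒∅≐↓ = ≐-trans (∁-resp-≐ ⇒∅≐∁↓) (∁-∁ dne)

    ∁-pseudocomplement-∩ : {U V : Subset X} → ∁ ((U ⇒ ∅) ∩ V) ≐ ↓ U ∪ ∁ V
    ∁-pseudocomplement-∩ = ≐-trans (∁-∩ dne) (∪-resp-≐ ∁⇒∅≐↓ ≐-refl)

module ModalProperties (M : ModalEsakiaSpace) where
  open ModalEsakiaSpace M
  open SubsetProperties
  open UpSetProperties esakia

  𝒰-closed : DoubleNegationElimination 0ℓ → 𝒰-Closed M
  𝒰-closed dne = record
    { ∩-cl = clopenUp-∩ dne
    ; ∪-cl = clopenUp-∪
    ; ⇒-cl = clopenUp-⇒ dne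
    ; ∅-cl = clopenUp-∅
    ; X-cl = clopenUp-Whole
    }

  𝒰-isHeytingAlgebra : (c : 𝒰-Closed M) →
    LS.IsHeytingAlgebra (_≈𝒰_ M) (_≤𝒰_ M) (_∨𝒰_ M c) (_∧𝒰_ M c) (_⇨𝒰_ M c) (⊤𝒰 M c) (⊥𝒰 M c)
  𝒰-isHeytingAlgebra c = record
    { isBoundedLattice = record
      { isLattice = record
        { isPartialOrder = On.isPartialOrder proj₁ ⊆-isPartialOrder
        ; supremum = λ A B → let l , r , lub = ∪-supremum (proj₁ A) (proj₁ B) in l , r , lub ∘ proj₁
        ; infimum  = λ A B → let l , r , glb = ∩-infimum (proj₁ A) (proj₁ B) in l , r , glb ∘ proj₁
        }
      ; maximum = λ _ _ _ → tt
      ; minimum = λ _ _ ()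
      }
    ; exponential = λ W _ _ → ⇒-residual (proj₂ (proj₂ W)) , ⇒-counit
    }

  □η-resp-≐ : {U V : Subset X} → U ≐ V → □η U ≐ □η V
  □η-resp-≐ U≐V = (λ _ → η₁-resp U≐V) , (λ _ → η₁-resp (≐-sym U≐V))

  ◇η-resp-≐ : {U V : Subset X} → U ≐ V → ◇η U ≐ ◇η V
  ◇η-resp-≐ U≐V = ∁-resp-≐ ((λ _ → η₂-resp (∁-resp-≐ U≐V)) , (λ _ → η₂-resp (∁-resp-≐ (≐-sym U≐V))))

  □η-∩-◇η-pseudocomplement-∩ : DoubleNegationElimination 0ℓ → {U V : Subset X} →
    ClopenUp U → ClopenUp V → □η U ∩ ◇η ((U ⇒ ∅) ∩ V) ⊆ ∅
  □η-∩-◇η-pseudocomplement-∩ dne pU pV x (U∈η₁x , ◇) =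
    ◇ (η₂-resp (≐-sym (∁-pseudocomplement-∩ dne)) (η₁→η₂ pU pV U∈η₁x))

proposition14 : ExcludedMiddle 0ℓ → (M : ModalEsakiaSpace) → 𝒰IsModalHeytingAlgebra M
proposition14 em M = closed , record
  { isHeytingAlgebra = 𝒰-isHeytingAlgebra closed
  ; □-cong = □η-resp-≐
  ; ◇-cong = ◇η-resp-≐
  ; axiom  = λ (U , pU) (V , pV) → □η-∩-◇η-pseudocomplement-∩ dne pU pV , λ _ ()
  }
  where
  open ModalProperties M
  dne : DoubleNegationElimination 0ℓ
  dne = em⇒dne em
  closed : 𝒰-Closed M
  closed = 𝒰-closed dne
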